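{- Let $G$ be an arbitrary graph of order $n$, let $x\in V(G)$, and let $\alpha$ be an optimal ordering of $G$. Then $\mathrm{prf}_{\alpha}(G)\ge \mathrm{prf}_{\alpha_x}(G-x)+d(x)$, where $d(x)=|N(x)|$ is the degree of $x$.
   Context: An ordering of a graph $G=(V,E)$ is a bijection $\alpha:V\to\{1,\dots,|V|\}$. For $v\in V$, $N(v)=\{u\in V: uv\in E\}$ and $N[v]=N(v)\cup\{v\}$. The profile of a vertex $z$ in $\alpha$ is $\mathrm{prf}_\alpha(G,z)=\alpha(z)-\min\{\alpha(w): w\in N[z]\}$, and $\mathrm{prf}_\alpha(G)=\sum_{z\in V}\mathrm{prf}_\alpha(G,z)$. An ordering $\alpha$ is optimal if $\mathrm{prf}_\alpha(G)$ is minimum over all orderings of $G$. For $x\in V$, $\alpha_x$ denotes the ordering of $G-x$ with $\alpha_x(u)<\alpha_x(v)$ iff $\alpha(u)<\alpha(v)$ for all $u,v\in V\setminus\{x\}$. -}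

module Defs where

open import Data.Bool using (Bool; true; false; if_then_else_; _∨_; T)
open import Data.Nat using (ℕ; zero; suc; _∸_; _⊓_; _+_; _≤_; _<_)
open import Data.Fin using (Fin; toℕ; punchIn)
open import Data.Fin.Properties using (_≟_)
open import Data.List using (List; foldr; map; allFin)
open import Data.Nat.ListAction using (sum)
open import Data.Product using (_×_)
open import Relation.Nullary.Decidable using (⌊_⌋)
open import Relation.Binary.PropositionalEquality using (_≡_)
open import Function.Definitions using (Bijective)
open import Function.Bundles using (_⇔_)

record Graph (n : ℕ) : Set where
  field
    adj    : Fin n → Fin n → Bool
    sym    : ∀ u v → adj u v ≡ adj v u
    irrefl : ∀ v → adj v v ≡ false
open Graph public

-- An ordering of G: a bijection V → {1..n}; we use {0..n-1} = Fin n
-- (the shift by one does not affect profiles, which are differences).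
IsOrdering : ∀ {n} → (Fin n → Fin n) → Set
IsOrdering α = Bijective _≡_ _≡_ α

inClosedNbhd : ∀ {n} → Graph n → Fin n → Fin n → Bool
inClosedNbhd G z w = adj G z w ∨ ⌊ w ≟ z ⌋

-- min { α(w) : w ∈ N[z] }   (z ∈ N[z], so starting the fold at α(z) is harmless)
minClosedNbhd : ∀ {n} → Graph n → (Fin n → Fin n) → Fin n → ℕ
minClosedNbhd {n} G α z =
  foldr (λ w m → if inClosedNbhd G z w then toℕ (α w) ⊓ m else m)
        (toℕ (α z)) (allFin n)

prfVertex : ∀ {n} → Graph n → (Fin n → Fin n) → Fin n → ℕ
prfVertex G α z = toℕ (α z) ∸ minClosedNbhd G α z

prf : ∀ {n} → Graph n → (Fin n → Fin n) → ℕ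
prf {n} G α = sum (map (prfVertex G α) (allFin n))

IsOptimal : ∀ {n} → Graph n → (Fin n → Fin n) → Set
IsOptimal {n} G α = IsOrdering α × (∀ (γ : Fin n → Fin n) → IsOrdering γ → prf G α ≤ prf G γ)

degree : ∀ {n} → Graph n → Fin n → ℕ
degree {n} G x = sum (map (λ w → if adj G x w then 1 else 0) (allFin n))

delete : ∀ {n} → Graph (suc n) → Fin (suc n) → Graph n
delete G x = record
  { adj    = λ u v → adj G (punchIn x u) (punchIn x v)
  ; sym    = λ u v → sym G (punchIn x u) (punchIn x v)
  ; irrefl = λ v → irrefl G (punchIn x v)
  }

IsInducedOrdering : ∀ {n} → Fin (suc n) → (Fin (suc n) → Fin (suc n)) → (Fin n → Fin n) → Set
IsInducedOrdering {n} x α β =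
  IsOrdering β ×
  (∀ (u v : Fin n) → (toℕ (β u) < toℕ (β v)) ⇔ (toℕ (α (punchIn x u)) < toℕ (α (punchIn x v))))

{-# OPTIONS --safe #-}
-- Deleting x shifts every vertex placed after x one position to the left and leaves
-- the others in place.  So no other vertex u gains profile: its new neighbourhood
-- minimum is attained at a vertex of N[u], and shifting shrinks gaps.  A neighbour u
-- of x placed after x even loses at least one: the minimum of N[u] lies at or before x,
-- so the shifted positions of N[u] − x stay at or above it while u moves down by one.
-- The neighbours of x placed before x occupy distinct positions between min N[x] and x,
-- so there are at most prf(x) of them.  Adding up,
-- prf(G) ≥ prf(G − x) + (later neighbours) + (earlier neighbours).
module Submission where

open import Defs
open import Data.Nat using (ℕ; suc; _+_; _≤_; zero; _∸_; _⊓_; _<_; _<ᵇ_; z≤n; s≤s)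
open import Data.Fin as Fin using (Fin; toℕ; punchIn)

open import Data.Nat.Properties hiding (_≟_)
open import Algebra.Properties.CommutativeMonoid.Sum +-0-commutativeMonoid
  using (sum; sum-cong-≗; sum-remove; sum-permute; sum-replicate-zero; ∑-distrib-+)
open import Algebra.Properties.CommutativeSemigroup +-commutativeSemigroup using (x∙yz≈y∙xz)
open import Data.Bool using (Bool; true; false; _∧_; not; T; if_then_else_)
open import Data.Bool.Properties using (T-∧; T-∨; T-≡)
open import Data.Fin.Properties using (_≟_; toℕ<n; toℕ-injective; punchInᵢ≢i)
open import Data.List using (List; []; _∷_; foldr; map; allFin; tabulate)
open import Data.List.Membership.Propositional using (_∈_)
open import Data.List.Membership.Propositional.Properties using (∈-allFin)
open import Data.List.Properties using (map-tabulate)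
open import Data.List.Relation.Unary.Any using (here; there)
import Data.Nat.ListAction as List
open import Data.Product using (∃-syntax; _×_; _,_; proj₁; proj₂)
open import Data.Sum as Sum using (_⊎_; inj₁; inj₂)
open import Function using (_∘_; id)
open import Function.Bundles using (Equivalence; _⇔_; mk⤖)
open import Function.Properties.Bijection using (⤖⇒↔)
open import Relation.Binary.PropositionalEquality as ≡ using (_≡_; refl; trans; cong; cong₂)
open import Relation.Nullary.Decidable using (fromWitness; toWitness)
open import Relation.Nullary.Negation using (contradiction)
open import Relation.Nullary.Reflects using (ofʸ; ofⁿ; fromEquivalence; det)

open Equivalence using (to; from)

𝟙 : Bool → ℕ
𝟙 b = if b then 1 else 0

𝟙-∧-split : ∀ b p → 𝟙 (b ∧ p) + 𝟙 (b ∧ not p) ≡ 𝟙 b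
𝟙-∧-split false p     = refl
𝟙-∧-split true  false = refl
𝟙-∧-split true  true  = refl

<ᵇ-cong-⇔ : ∀ {m n m′ n′} → (m < n) ⇔ (m′ < n′) → (m <ᵇ n) ≡ (m′ <ᵇ n′)
<ᵇ-cong-⇔ {m} {n} {m′} {n′} m<n⇔m′<n′ =
  det (fromEquivalence (to m<n⇔m′<n′ ∘ <ᵇ⇒< m n) (<⇒<ᵇ ∘ from m<n⇔m′<n′)) (<ᵇ-reflects-< m′ n′)

sum-tabulate : ∀ {k} (f : Fin k → ℕ) → List.sum (tabulate f) ≡ sum f
sum-tabulate {zero}  f = refl
sum-tabulate {suc k} f = cong (f Fin.zero +_) (sum-tabulate (f ∘ Fin.suc))

sum-map-allFin : ∀ {k} (f : Fin k → ℕ) → List.sum (map f (allFin k)) ≡ sum f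
sum-map-allFin f = trans (cong List.sum (map-tabulate id f)) (sum-tabulate f)

∑-mono-≤ : ∀ {k} {f g : Fin k → ℕ} → (∀ i → f i ≤ g i) → sum f ≤ sum g
∑-mono-≤ {zero}  f≤g = z≤n
∑-mono-≤ {suc k} f≤g = +-mono-≤ (f≤g Fin.zero) (∑-mono-≤ (f≤g ∘ Fin.suc))

sum-∘-bijection : ∀ {k} {π : Fin k → Fin k} → IsOrdering π → (f : Fin k → ℕ) → sum (f ∘ π) ≡ sum f
sum-∘-bijection π-bij f = ≡.sym (sum-permute f (⤖⇒↔ (mk⤖ π-bij)))

count-<-allFin : ∀ {k} t → t ≤ k → sum (λ (j : Fin k) → 𝟙 (toℕ j <ᵇ t)) ≡ t
count-<-allFin {k}     zero    _           = sum-replicate-zero k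
count-<-allFin {suc k} (suc t) (s≤s t≤k) = cong suc (count-<-allFin t t≤k)

count-<-bijection : ∀ {k} {α : Fin k → Fin k} → IsOrdering α →
                    ∀ t → t ≤ k → sum (λ w → 𝟙 (toℕ (α w) <ᵇ t)) ≡ t
count-<-bijection α-bij t t≤k = trans (sum-∘-bijection α-bij _) (count-<-allFin t t≤k)

rank : ∀ {k} {α : Fin k → Fin k} → IsOrdering α →
       ∀ v → sum (λ w → 𝟙 (toℕ (α w) <ᵇ toℕ (α v))) ≡ toℕ (α v)
rank {α = α} α-bij v = count-<-bijection α-bij _ (<⇒≤ (toℕ<n (α v)))

𝟙-between : ∀ q {m s t} → s ≤ t → (T q → s ≤ m × m < t) → 𝟙 q + 𝟙 (m <ᵇ s) ≤ 𝟙 (m <ᵇ t)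
𝟙-between q {m} {s} {t} s≤t between
  with q | m <ᵇ s | <ᵇ-reflects-< m s | m <ᵇ t | <ᵇ-reflects-< m t
... | true  | true  | ofʸ m<s | _     | _        = contradiction (proj₁ (between _)) (<⇒≱ m<s)
... | true  | false | _       | true  | _        = ≤-refl
... | true  | false | _       | false | ofⁿ m≮t = contradiction (proj₂ (between _)) m≮t
... | false | true  | ofʸ m<s | false | ofⁿ m≮t = contradiction (<-≤-trans m<s s≤t) m≮t
... | false | true  | _       | true  | _        = ≤-refl
... | false | false | _       | _     | _        = z≤n

count-between : ∀ {k} {α : Fin k → Fin k} → IsOrdering α → (Q : Fin k → Bool) →
                ∀ {s t} → s ≤ t → t ≤ k →
                (∀ w → T (Q w) → s ≤ toℕ (α w) × toℕ (α w) < t) → sum (𝟙 ∘ Q) ≤ t ∸ s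
count-between {α = α} α-bij Q {s} {t} s≤t t≤k between = m+n≤o⇒m≤o∸n (sum (𝟙 ∘ Q)) (begin
    sum (𝟙 ∘ Q) + s
  ≡⟨ cong (sum (𝟙 ∘ Q) +_) (≡.sym (count-<-bijection α-bij s (≤-trans s≤t t≤k))) ⟩
    sum (𝟙 ∘ Q) + sum (λ w → 𝟙 (toℕ (α w) <ᵇ s))
  ≡⟨ ≡.sym (∑-distrib-+ (𝟙 ∘ Q) _) ⟩
    sum (λ w → 𝟙 (Q w) + 𝟙 (toℕ (α w) <ᵇ s))
  ≤⟨ ∑-mono-≤ (λ w → 𝟙-between (Q w) s≤t (between w)) ⟩
    sum (λ w → 𝟙 (toℕ (α w) <ᵇ t))
  ≡⟨ count-<-bijection α-bij t t≤k ⟩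
    t ∎)
  where open ≤-Reasoning

module _ {A : Set} (P : A → Bool) (h : A → ℕ) (init : ℕ) where

  filteredMin : List A → ℕ
  filteredMin = foldr (λ w m → if P w then h w ⊓ m else m) init

  filteredMin-≤ : ∀ {ws w} → w ∈ ws → T (P w) → filteredMin ws ≤ h w
  filteredMin-≤ {w ∷ ws} (here refl) Pw with P w
  ... | true = m⊓n≤m (h w) _
  filteredMin-≤ {v ∷ ws} (there w∈ws) Pw with P v
  ... | true  = ≤-trans (m⊓n≤n (h v) _) (filteredMin-≤ w∈ws Pw)
  ... | false = filteredMin-≤ w∈ws Pw

  filteredMin-attained : ∀ ws → filteredMin ws ≡ init ⊎ ∃[ w ] T (P w) × filteredMin ws ≡ h w
  filteredMin-attained []       = inj₁ refl
  filteredMin-attained (v ∷ ws) with P v in Pv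
  ... | false = filteredMin-attained ws
  ... | true with ⊓-sel (h v) (filteredMin ws)
  ...   | inj₁ min≡hv = inj₂ (v , from T-≡ Pv , min≡hv)
  ...   | inj₂ min≡rest rewrite min≡rest = filteredMin-attained ws

inClosedNbhd-refl : ∀ {k} (G : Graph k) z → T (inClosedNbhd G z z)
inClosedNbhd-refl G z = from (T-∨ {adj G z z}) (inj₂ (fromWitness refl))

adj⇒inClosedNbhd : ∀ {k} (G : Graph k) {z w} → T (adj G z w) → T (inClosedNbhd G z w)
adj⇒inClosedNbhd G {z} {w} = from (T-∨ {adj G z w}) ∘ inj₁

inClosedNbhd-delete : ∀ {k} (G : Graph (suc k)) x {u v} →
                      T (inClosedNbhd (delete G x) u v) → T (inClosedNbhd G (punchIn x u) (punchIn x v))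
inClosedNbhd-delete G x {u} {v} =
  from (T-∨ {adj G (punchIn x u) (punchIn x v)}) ∘
  Sum.map₂ (fromWitness ∘ cong (punchIn x) ∘ toWitness {a? = v ≟ u}) ∘
  to (T-∨ {adj G (punchIn x u) (punchIn x v)})

minClosedNbhd-≤ : ∀ {k} (G : Graph k) (α : Fin k → Fin k) z {w} →
                  T (inClosedNbhd G z w) → minClosedNbhd G α z ≤ toℕ (α w)
minClosedNbhd-≤ G α z {w} = filteredMin-≤ (inClosedNbhd G z) (toℕ ∘ α) (toℕ (α z)) (∈-allFin w)

minClosedNbhd-attained : ∀ {k} (G : Graph k) (α : Fin k → Fin k) z →
                         ∃[ w ] T (inClosedNbhd G z w) × minClosedNbhd G α z ≡ toℕ (α w)
minClosedNbhd-attained {k} G α z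
  with filteredMin-attained (inClosedNbhd G z) (toℕ ∘ α) (toℕ (α z)) (allFin k)
... | inj₁ min≡αz = z , inClosedNbhd-refl G z , min≡αz
... | inj₂ attained = attained

-- The new position of the vertex at position t once position c is deleted
-- (ℕ's counterpart of Fin's punchOut).
closeGap : ℕ → ℕ → ℕ
closeGap c t = t ∸ 𝟙 (c <ᵇ t)

closeGap-+1 : ∀ {c t} → c < t → closeGap c t + 1 ≡ t
closeGap-+1 {c} {t} c<t with c <ᵇ t | <ᵇ-reflects-< c t
... | true  | _       = m∸n+n≡m (≤-trans (s≤s z≤n) c<t)
... | false | ofⁿ c≮t = contradiction c<t c≮t

≤-closeGap : ∀ {m c t} → m ≤ c → m ≤ t → m ≤ closeGap c t
≤-closeGap {m} {c} {t} m≤c m≤t with c <ᵇ t | <ᵇ-reflects-< c t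
... | true  | ofʸ c<t = ≤-trans m≤c (<⇒≤pred c<t)
... | false | _       = m≤t

closeGap-∸-closeGap-≤ : ∀ c {m s t} → m ≤ s → closeGap c t ∸ closeGap c s ≤ t ∸ m
closeGap-∸-closeGap-≤ c {m} {s} {t} m≤s = ≤-trans (closeGap-Lipschitz c {s} {t}) (∸-monoʳ-≤ t m≤s)
  where
  closeGap-Lipschitz : ∀ c {s t} → closeGap c t ∸ closeGap c s ≤ t ∸ s
  closeGap-Lipschitz c {s} {t} with c <ᵇ t | <ᵇ-reflects-< c t | c <ᵇ s | <ᵇ-reflects-< c s
  ... | true  | _       | true  | ofʸ c<s =
    ≤-reflexive (trans (∸-+-assoc t 1 (s ∸ 1)) (cong (t ∸_) (m+[n∸m]≡n (≤-trans (s≤s z≤n) c<s))))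
  ... | true  | _       | false | _       = ∸-monoˡ-≤ s (m∸n≤m t 1)
  ... | false | ofⁿ c≮t | true  | ofʸ c<s =
    ≤-trans (≤-reflexive (m≤n⇒m∸n≡0 (≤-trans (≮⇒≥ c≮t) (<⇒≤pred c<s)))) z≤n
  ... | false | _       | false | _       = ≤-refl

closeGap-∸-closeGap-+1 : ∀ {m c s t} → c < t → m ≤ c → m ≤ s → closeGap c t ∸ closeGap c s + 1 ≤ t ∸ m
closeGap-∸-closeGap-+1 {m} {c} {s} {t} c<t m≤c m≤s = begin
    closeGap c t ∸ closeGap c s + 1  ≤⟨ +-monoˡ-≤ 1 (∸-monoʳ-≤ (closeGap c t) (≤-closeGap m≤c m≤s)) ⟩
    closeGap c t ∸ m + 1             ≡⟨ ≡.sym (+-∸-comm 1 (≤-closeGap m≤c m≤t)) ⟩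
    closeGap c t + 1 ∸ m             ≡⟨ cong (_∸ m) (closeGap-+1 c<t) ⟩
    t ∸ m                            ∎
  where
  open ≤-Reasoning
  m≤t : m ≤ t
  m≤t = ≤-trans m≤c (<⇒≤ c<t)

module Deletion {n} (G : Graph (suc n)) (x : Fin (suc n))
                {α : Fin (suc n) → Fin (suc n)} (α-bij : IsOrdering α)
                {αₓ : Fin n → Fin n} (αₓ-induced : IsInducedOrdering x α αₓ) where

  pos : Fin (suc n) → ℕ
  pos w = toℕ (α w)

  posₓ : Fin n → ℕ
  posₓ u = toℕ (αₓ u)

  rank-after-delete : ∀ u → posₓ u + 𝟙 (pos x <ᵇ pos (punchIn x u)) ≡ pos (punchIn x u)
  rank-after-delete u = begin
      posₓ u + 𝟙 (pos x <ᵇ t)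
    ≡⟨ cong (_+ 𝟙 (pos x <ᵇ t)) (≡.sym (rank (proj₁ αₓ-induced) u)) ⟩
      sum (λ w → 𝟙 (posₓ w <ᵇ posₓ u)) + 𝟙 (pos x <ᵇ t)
    ≡⟨ cong (_+ 𝟙 (pos x <ᵇ t)) (sum-cong-≗ (λ w → cong 𝟙 (<ᵇ-cong-⇔ (proj₂ αₓ-induced w u)))) ⟩
      sum (λ w → 𝟙 (pos (punchIn x w) <ᵇ t)) + 𝟙 (pos x <ᵇ t)
    ≡⟨ +-comm _ (𝟙 (pos x <ᵇ t)) ⟩
      𝟙 (pos x <ᵇ t) + sum (λ w → 𝟙 (pos (punchIn x w) <ᵇ t))
    ≡⟨ ≡.sym (sum-remove (λ w → 𝟙 (pos w <ᵇ t))) ⟩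
      sum (λ w → 𝟙 (pos w <ᵇ t))
    ≡⟨ rank α-bij (punchIn x u) ⟩
      t ∎
    where
    open ≡.≡-Reasoning
    t : ℕ
    t = pos (punchIn x u)

  posₓ≡closeGap : ∀ u → posₓ u ≡ closeGap (pos x) (pos (punchIn x u))
  posₓ≡closeGap u = begin
      posₓ u                   ≡⟨ ≡.sym (m+n∸n≡m (posₓ u) [x<u]) ⟩
      posₓ u + [x<u] ∸ [x<u]   ≡⟨ cong (_∸ [x<u]) (rank-after-delete u) ⟩
      closeGap (pos x) (pos (punchIn x u)) ∎
    where
    open ≡.≡-Reasoning
    [x<u] : ℕ
    [x<u] = 𝟙 (pos x <ᵇ pos (punchIn x u))

  earlierNeighbour laterNeighbour : Fin (suc n) → Bool
  earlierNeighbour w = adj G x w ∧ (pos w <ᵇ pos x)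
  laterNeighbour   w = adj G x w ∧ not (pos w <ᵇ pos x)

  degree-split : degree G x ≡ sum (𝟙 ∘ earlierNeighbour) + sum (𝟙 ∘ laterNeighbour ∘ punchIn x)
  degree-split = begin
      degree G x
    ≡⟨ sum-map-allFin (𝟙 ∘ adj G x) ⟩
      sum (𝟙 ∘ adj G x)
    ≡⟨ ≡.sym (sum-cong-≗ (λ w → 𝟙-∧-split (adj G x w) (pos w <ᵇ pos x))) ⟩
      sum (λ w → 𝟙 (earlierNeighbour w) + 𝟙 (laterNeighbour w))
    ≡⟨ ∑-distrib-+ (𝟙 ∘ earlierNeighbour) (𝟙 ∘ laterNeighbour) ⟩
      sum (𝟙 ∘ earlierNeighbour) + sum (𝟙 ∘ laterNeighbour)
    ≡⟨ cong (sum (𝟙 ∘ earlierNeighbour) +_) (sum-remove (𝟙 ∘ laterNeighbour)) ⟩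
      sum (𝟙 ∘ earlierNeighbour) + (𝟙 (laterNeighbour x) + sum (𝟙 ∘ laterNeighbour ∘ punchIn x))
    ≡⟨ cong (λ b → sum (𝟙 ∘ earlierNeighbour) + (𝟙 (b ∧ _) + sum (𝟙 ∘ laterNeighbour ∘ punchIn x)))
            (irrefl G x) ⟩
      sum (𝟙 ∘ earlierNeighbour) + sum (𝟙 ∘ laterNeighbour ∘ punchIn x) ∎
    where open ≡.≡-Reasoning

  earlierNeighbours-≤-prfVertex : sum (𝟙 ∘ earlierNeighbour) ≤ prfVertex G α x
  earlierNeighbours-≤-prfVertex =
    count-between α-bij earlierNeighbour
      (minClosedNbhd-≤ G α x (inClosedNbhd-refl G x)) (<⇒≤ (toℕ<n (α x))) between
    where
    between : ∀ w → T (earlierNeighbour w) → minClosedNbhd G α x ≤ pos w × pos w < pos x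
    between w earlier with to (T-∧ {adj G x w}) earlier
    ... | x~w , w<x = minClosedNbhd-≤ G α x (adj⇒inClosedNbhd G x~w) , <ᵇ⇒< (pos w) (pos x) w<x

  closeGap-∸-+-later-≤ : ∀ u {s} → minClosedNbhd G α (punchIn x u) ≤ s →
                   closeGap (pos x) (pos (punchIn x u)) ∸ closeGap (pos x) s + 𝟙 (laterNeighbour (punchIn x u))
                   ≤ pos (punchIn x u) ∸ minClosedNbhd G α (punchIn x u)
  closeGap-∸-+-later-≤ u {s} m≤s
    with adj G x (punchIn x u) in x~u | pos (punchIn x u) <ᵇ pos x | <ᵇ-reflects-< (pos (punchIn x u)) (pos x)
  ... | false | _     | _        = ≤-trans (≤-reflexive (+-identityʳ _)) (closeGap-∸-closeGap-≤ (pos x) m≤s)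
  ... | true  | true  | _        = ≤-trans (≤-reflexive (+-identityʳ _)) (closeGap-∸-closeGap-≤ (pos x) m≤s)
  ... | true  | false | ofⁿ u≮x = closeGap-∸-closeGap-+1 x<u m≤x m≤s
    where
    x<u : pos x < pos (punchIn x u)
    x<u = ≤∧≢⇒< (≮⇒≥ u≮x) (λ x≡u → punchInᵢ≢i x u (proj₁ α-bij (toℕ-injective (≡.sym x≡u))))
    m≤x : minClosedNbhd G α (punchIn x u) ≤ pos x
    m≤x = minClosedNbhd-≤ G α (punchIn x u)
            (adj⇒inClosedNbhd G (from T-≡ (trans (sym G (punchIn x u) x) x~u)))

  prfVertex-delete-≤ : ∀ u → prfVertex (delete G x) αₓ u + 𝟙 (laterNeighbour (punchIn x u))
                              ≤ prfVertex G α (punchIn x u)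
  prfVertex-delete-≤ u with minClosedNbhd-attained (delete G x) αₓ u
  ... | v , v∈N[u] , min≡v rewrite min≡v | posₓ≡closeGap u | posₓ≡closeGap v =
    closeGap-∸-+-later-≤ u (minClosedNbhd-≤ G α (punchIn x u) (inClosedNbhd-delete G x v∈N[u]))

lemma2p3 : (n : ℕ) (G : Graph (suc n)) (x : Fin (suc n)) (α : Fin (suc n) → Fin (suc n))
    → IsOptimal G α
    → (αx : Fin n → Fin n) → IsInducedOrdering x α αx
    → prf (delete G x) αx + degree G x ≤ prf G α
lemma2p3 n G x α (α-bij , _) αx αx-induced = begin
    prf (delete G x) αx + degree G x
  ≡⟨ cong₂ _+_ (sum-map-allFin prfₓ) degree-split ⟩
    sum prfₓ + (sum (𝟙 ∘ earlierNeighbour) + sum (𝟙 ∘ laterNeighbour ∘ punchIn x))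
  ≡⟨ x∙yz≈y∙xz (sum prfₓ) (sum (𝟙 ∘ earlierNeighbour)) (sum (𝟙 ∘ laterNeighbour ∘ punchIn x)) ⟩
    sum (𝟙 ∘ earlierNeighbour) + (sum prfₓ + sum (𝟙 ∘ laterNeighbour ∘ punchIn x))
  ≡⟨ cong (sum (𝟙 ∘ earlierNeighbour) +_) (≡.sym (∑-distrib-+ prfₓ (𝟙 ∘ laterNeighbour ∘ punchIn x))) ⟩
    sum (𝟙 ∘ earlierNeighbour) + sum (λ u → prfₓ u + 𝟙 (laterNeighbour (punchIn x u)))
  ≤⟨ +-mono-≤ earlierNeighbours-≤-prfVertex (∑-mono-≤ prfVertex-delete-≤) ⟩
    prfVertex G α x + sum (prfVertex G α ∘ punchIn x)
  ≡⟨ ≡.sym (sum-remove (prfVertex G α)) ⟩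
    sum (prfVertex G α)
  ≡⟨ ≡.sym (sum-map-allFin (prfVertex G α)) ⟩
    prf G α ∎
  where
  open Deletion G x α-bij αx-induced
  open ≤-Reasoning
  prfₓ : Fin n → ℕ
  prfₓ = prfVertex (delete G x) αx
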